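{- Let $\Delta$ be a bi-transitive bipartite digraph with colour classes $V_1,V_2$ and edge set $E$, satisfying property N1. Let $u,w\in V_1$ and $v,z\in V_2$ be four pairwise distinct vertices such that $wz$ and $zw$ are both edges. If $|N(u)|=|N(v)|=1$ and $uz\in E$, then $vw\notin E$.
   Context: Digraphs have no loops or multiple edges; $N(x)$ is the set of out-neighbours of $x$ and $N(S)=\bigcup_{s\in S}N(s)$. A bipartite digraph has two colour classes with every edge joining different classes; it is bi-transitive if whenever $u_1v_1,v_1u_2,u_2v_2\in E$, also $u_1v_2\in E$. Property N1: for any two vertices $x,y$ with $x\notin N(y)$ and $y\notin N(x)$ (independent vertices), $N(x)\cap N(N(y))=\emptyset$ and $N(y)\cap N(N(x))=\emptyset$. -}

module Defs where

open import Level using (Level; _⊔_; suc)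
open import Data.Bool using (Bool; true; false)
open import Data.Product using (Σ; ∃; _×_; _,_)
open import Relation.Nullary using (¬_)
open import Relation.Binary.PropositionalEquality using (_≡_; _≢_)

-- A digraph: vertex type V and edge relation E (E x y means xy is an edge,
-- i.e. y ∈ N(x)); no loops. Multiple edges are excluded automatically
-- since E is a relation.
record Digraph (ℓv ℓe : Level) : Set (Level.suc (ℓv ⊔ ℓe)) where
  field
    V      : Set ℓv
    E      : V → V → Set ℓe
    noLoop : ∀ x → ¬ E x x

module _ {ℓv ℓe} (D : Digraph ℓv ℓe) where
  open Digraph D

  _∈N_ : V → V → Set ℓe
  y ∈N x = E x y

  _∈NN_ : V → V → Set (ℓv ⊔ ℓe)
  y ∈NN x = ∃ λ b → E x b × E b y

  OutDegreeOne : V → Set (ℓv ⊔ ℓe)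
  OutDegreeOne x = ∃ λ y → E x y × (∀ y′ → E x y′ → y′ ≡ y)

  -- bipartite with respect to a colouring; colour classes V₁ = col⁻¹ false,
  -- V₂ = col⁻¹ true
  IsBipartiteColouring : (V → Bool) → Set (ℓv ⊔ ℓe)
  IsBipartiteColouring col = ∀ x y → E x y → col x ≢ col y

  BiTransitive : Set (ℓv ⊔ ℓe)
  BiTransitive = ∀ u₁ v₁ u₂ v₂ → E u₁ v₁ → E v₁ u₂ → E u₂ v₂ → E u₁ v₂

  Independent : V → V → Set ℓe
  Independent x y = ¬ E y x × ¬ E x y

  N1 : Set (ℓv ⊔ ℓe)
  N1 = ∀ x y → Independent x y →
         (∀ a → a ∈N x → ¬ (a ∈NN y)) × (∀ a → a ∈N y → ¬ (a ∈NN x))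

-- Under N1 an out-neighbour of one of two independent vertices is never a
-- second out-neighbour of the other. Here u and v are independent, since
-- their unique out-neighbours z and w are distinct from v and u; so w, a
-- second out-neighbour of u via z, cannot be an out-neighbour of v.
module Submission where

open import Defs
open import Level using (Level)
open import Data.Bool using (Bool; true; false)
open import Data.Product using (_,_; proj₂)
open import Relation.Nullary using (¬_)
open import Relation.Binary.PropositionalEquality using (_≡_; _≢_; trans; sym)

module _ {ℓv ℓe : Level} (D : Digraph ℓv ℓe) where
  open Digraph D

  outDegreeOne⇒¬E : ∀ {x y y′} → OutDegreeOne D x → E x y → y′ ≢ y → ¬ E x y′
  outDegreeOne⇒¬E (_ , _ , unique) exy y′≢y exy′ =
    y′≢y (trans (unique _ exy′) (sym (unique _ exy)))

  N1⇒∉N-of-∈NN : N1 D → ∀ {x y a} → Independent D x y → _∈NN_ D a x → ¬ _∈N_ D a y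
  N1⇒∉N-of-∈NN n1 {x} {y} {a} ind a∈NNx a∈Ny = proj₂ (n1 x y ind) a a∈Ny a∈NNx

lemma11 : ∀ {ℓv ℓe : Level} (D : Digraph ℓv ℓe) (col : Digraph.V D → Bool) →
    IsBipartiteColouring D col → BiTransitive D → N1 D →
    (u w v z : Digraph.V D) →
    col u ≡ false → col w ≡ false → col v ≡ true → col z ≡ true →
    u ≢ w → u ≢ v → u ≢ z → w ≢ v → w ≢ z → v ≢ z →
    Digraph.E D w z → Digraph.E D z w →
    OutDegreeOne D u → OutDegreeOne D v → Digraph.E D u z →
    ¬ Digraph.E D v w
lemma11 D _ _ _ n1 u w v z _ _ _ _ u≢w _ _ _ _ v≢z _ ezw deg-u deg-v euz evw =
  N1⇒∉N-of-∈NN D n1 (¬evu , ¬euv) (z , euz , ezw) evw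
  where
  ¬evu : ¬ Digraph.E D v u
  ¬evu = outDegreeOne⇒¬E D deg-v evw u≢w
  ¬euv : ¬ Digraph.E D u v
  ¬euv = outDegreeOne⇒¬E D deg-u euz v≢z
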